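{- Let $n$ be a positive integer, $N=2n$, and let $d_1,\ldots,d_n\in (\mathbb{Z}/N)^*$. Then there exist $s_1,\ldots,s_n\in \{1,-1\}$ such that $$s_1d_1+\cdots+s_nd_n\equiv n \pmod{2n}.$$
   Context: $(\mathbb{Z}/N)^*$ denotes the group of units of $\mathbb{Z}/N$, i.e., residues coprime to $N$. -}

module Defs where

open import Data.Nat using (ℕ; suc)
open import Data.Integer using (ℤ; +_; _+_; _*_; ∣_∣; 0ℤ)
open import Data.Sign using (Sign)
open import Data.Fin using (Fin; zero; suc)
open import Data.Nat.Coprimality using (Coprime)

Σᶠ : (n : ℕ) → (Fin n → ℤ) → ℤ
Σᶠ ℕ.zero f = 0ℤ
Σᶠ (suc n) f = f zero + Σᶠ n (λ i → f (suc i))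

signℤ : Sign → ℤ
signℤ Sign.+ = + 1
signℤ Sign.- = Data.Integer.-_ (+ 1)

-- an integer representative of a unit of ℤ/N
IsUnitMod : ℕ → ℤ → Set
IsUnitMod N d = Coprime ∣ d ∣ N

-- Let A be the set of indices with s_i = -1, so that Σ s_i d_i = Σ d_i - 2 Σ_{i∈A} d_i. The d_i
-- are odd, hence Σ d_i = n + 2q, and it suffices to find A with Σ_{i∈A} d_i ≡ q (mod n). The
-- residues mod n of the subset sums of d_1, …, d_k form a set containing 0 which, because every
-- d_i is a unit mod n, has at least k + 1 elements or is everything: adjoining d_{k+1} either
-- enlarges it, or leaves it closed under translation by the unit d_{k+1}, which forces it to be
-- all of ℤ/n. For k = n the first alternative is impossible.
module Submission where

open import Defs
open import Data.Nat using (ℕ; NonZero; _*_)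
open import Data.Integer using (ℤ; +_; _-_)
open import Data.Integer.Divisibility using (_∣_)
open import Data.Sign using (Sign)
import Data.Sign as Sign
open import Data.Fin using (Fin)
open import Data.Product using (∃)

open import Data.Bool using (Bool; true; false; if_then_else_)
open import Data.Empty using (⊥-elim)
open import Data.Fin using (zero; suc; toℕ; fromℕ<)
open import Data.Fin.Properties using (toℕ<n; toℕ-fromℕ<; toℕ-injective)
open import Data.Fin.Subset using (Subset; _∈_; _⊆_; _⊂_; _∪_; ⁅_⁆; ∣_∣)
open import Data.Fin.Subset.Properties
  using (_∈?_; _⊂?_; p⊆p∪q; q⊆p∪q; x∈p∪q⁻; x∈⁅x⁆; x∈⁅y⁆⇒x≡y; ∣⁅x⁆∣≡1; ∣p∣≤n; p⊂q⇒∣p∣<∣q∣)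
open import Data.Integer as ℤ using (_+_; -_; 0ℤ; 1ℤ; _/ℕ_)
import Data.Integer.Properties as ℤ
open import Data.Integer.DivMod using (a≡a%ℕn+[a/ℕn]*n; n%ℕd<d)
open import Data.Integer.Divisibility.Signed as Signed using (divides)
open import Data.Integer.Tactic.RingSolver using (solve-∀)
open import Data.Nat as ℕ using (suc; _≤_; _<_; s≤s)
import Data.Nat.Properties as ℕ
import Data.Nat.Divisibility as ℕ
open import Data.Nat.Coprimality using (coprime-Bézout)
open import Data.Nat.GCD using (module Bézout)
open import Data.Product using (_,_)
open import Data.Sum using (_⊎_; inj₁; inj₂)
open import Data.Vec using (lookup; tabulate)
open import Data.Vec.Properties using (lookup∘tabulate; []=⇒lookup; lookup⇒[]=)
open import Data.Vec.Functional using (_∷_)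
open import Function using (_∘_)
open import Relation.Binary.Bundles using (Setoid)
open import Relation.Binary.PropositionalEquality
import Relation.Binary.Reasoning.Setoid
open import Relation.Nullary using (yes; no)
open import Relation.Nullary.Decidable using (decidable-stable)

infix 4 _≡_[mod_]

-- A record rather than an abbreviation of the divisibility, so that a and b can be inferred.
record _≡_[mod_] (a b : ℤ) (m : ℕ) : Set where
  constructor ≡-mod
  field m∣a-b : + m Signed.∣ a - b

open _≡_[mod_] using (m∣a-b)

module _ {m : ℕ} where

  ≡⇒≡-mod : ∀ {a b} → a ≡ b → a ≡ b [mod m ]
  ≡⇒≡-mod {a} refl = ≡-mod (divides 0ℤ (lemma a (+ m)))
    where lemma : ∀ a k → a - a ≡ 0ℤ ℤ.* k
          lemma = solve-∀

  ≡-mod-sym : ∀ {a b} → a ≡ b [mod m ] → b ≡ a [mod m ]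
  ≡-mod-sym {a} {b} (≡-mod p) = ≡-mod (subst (+ m Signed.∣_) (lemma a b) (Signed.∣m⇒∣-m p))
    where lemma : ∀ a b → - (a - b) ≡ b - a
          lemma = solve-∀

  ≡-mod-trans : ∀ {a b c} → a ≡ b [mod m ] → b ≡ c [mod m ] → a ≡ c [mod m ]
  ≡-mod-trans {a} {b} {c} (≡-mod p) (≡-mod q) =
    ≡-mod (subst (+ m Signed.∣_) (lemma a b c) (Signed.∣m∣n⇒∣m+n p q))
    where lemma : ∀ a b c → (a - b) + (b - c) ≡ a - c
          lemma = solve-∀

  +-cong-mod : ∀ {a b c d} → a ≡ b [mod m ] → c ≡ d [mod m ] → a + c ≡ b + d [mod m ]
  +-cong-mod {a} {b} {c} {d} (≡-mod p) (≡-mod q) =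
    ≡-mod (subst (+ m Signed.∣_) (lemma a b c d) (Signed.∣m∣n⇒∣m+n p q))
    where lemma : ∀ a b c d → (a - b) + (c - d) ≡ (a + c) - (b + d)
          lemma = solve-∀

  +-congˡ-mod : ∀ c {a b} → a ≡ b [mod m ] → c + a ≡ c + b [mod m ]
  +-congˡ-mod c = +-cong-mod (≡⇒≡-mod {a = c} refl)

  *-congˡ-mod : ∀ c {a b} → a ≡ b [mod m ] → c ℤ.* a ≡ c ℤ.* b [mod m ]
  *-congˡ-mod c {a} {b} (≡-mod p) =
    ≡-mod (subst (+ m Signed.∣_) (lemma c a b) (Signed.∣n⇒∣m*n c p))
    where lemma : ∀ c a b → c ℤ.* (a - b) ≡ c ℤ.* a - c ℤ.* b
          lemma = solve-∀

  *-congʳ-mod : ∀ c {a b} → a ≡ b [mod m ] → a ℤ.* c ≡ b ℤ.* c [mod m ]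
  *-congʳ-mod c {a} {b} a≡b = subst₂ _≡_[mod m ] (ℤ.*-comm c a) (ℤ.*-comm c b) (*-congˡ-mod c a≡b)

  ≡-mod-setoid : Setoid _ _
  ≡-mod-setoid = record
    { Carrier = ℤ
    ; _≈_ = _≡_[mod m ]
    ; isEquivalence = record { refl = ≡⇒≡-mod refl ; sym = ≡-mod-sym ; trans = ≡-mod-trans }
    }

  module ≡-mod-Reasoning = Relation.Binary.Reasoning.Setoid ≡-mod-setoid

multiple-offset⇒≡-mod : ∀ {m a b} q → a ≡ b + q ℤ.* + m → a ≡ b [mod m ]
multiple-offset⇒≡-mod {m} {b = b} q refl = ≡-mod (divides q (lemma b q (+ m)))
  where lemma : ∀ b q m → b + q ℤ.* m - b ≡ q ℤ.* m
        lemma = solve-∀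

-‿cong-mod : ∀ {m a b} → a ≡ b [mod m ] → - a ≡ - b [mod m ]
-‿cong-mod {a = a} {b} p =
  subst₂ _≡_[mod _ ] (ℤ.-1*i≡-i a) (ℤ.-1*i≡-i b) (*-congˡ-mod (- 1ℤ) p)

*-scale-mod : ∀ k {m a b} → a ≡ b [mod m ] → + k ℤ.* a ≡ + k ℤ.* b [mod k * m ]
*-scale-mod k {m} {a} {b} (≡-mod (divides q a-b≡qm)) = ≡-mod (divides q (begin
  + k ℤ.* a - + k ℤ.* b  ≡⟨ factor (+ k) a b ⟩
  + k ℤ.* (a - b)        ≡⟨ cong (+ k ℤ.*_) a-b≡qm ⟩
  + k ℤ.* (q ℤ.* + m)    ≡⟨ swap (+ k) q (+ m) ⟩
  q ℤ.* (+ k ℤ.* + m)    ≡⟨ cong (q ℤ.*_) (ℤ.pos-* k m) ⟨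
  q ℤ.* + (k * m)        ∎))
  where
  open ≡-Reasoning
  factor : ∀ k a b → k ℤ.* a - k ℤ.* b ≡ k ℤ.* (a - b)
  factor = solve-∀
  swap : ∀ k q m → k ℤ.* (q ℤ.* m) ≡ q ℤ.* (k ℤ.* m)
  swap = solve-∀

1+m*n≡o*p⇒ℤ : ∀ m n o p → 1 ℕ.+ m * n ≡ o * p → 1ℤ + + m ℤ.* + n ≡ + o ℤ.* + p
1+m*n≡o*p⇒ℤ m n o p eq = begin
  1ℤ + + m ℤ.* + n   ≡⟨ cong (_+_ 1ℤ) (ℤ.pos-* m n) ⟨
  + (1 ℕ.+ m * n)    ≡⟨ cong +_ eq ⟩
  + (o * p)          ≡⟨ ℤ.pos-* o p ⟩
  + o ℤ.* + p        ∎
  where open ≡-Reasoning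

⊆⇒⊇⊎⊂ : ∀ {k} {p q : Subset k} → p ⊆ q → q ⊆ p ⊎ p ⊂ q
⊆⇒⊇⊎⊂ {p = p} {q} p⊆q with p ⊂? q
... | yes p⊂q = inj₂ p⊂q
... | no p⊄q = inj₁ λ {x} x∈q → decidable-stable (x ∈? p) (λ x∉p → p⊄q (p⊆q , x , x∈q , x∉p))

selectedSum : (k : ℕ) → (Fin k → Bool) → (Fin k → ℤ) → ℤ
selectedSum k A d = Σᶠ k (λ i → if A i then d i else 0ℤ)

module Residues (n : ℕ) .{{_ : NonZero n}} where

  toℤ : Fin n → ℤ
  toℤ x = + toℕ x

  residue : ℤ → Fin n
  residue a = fromℕ< (n%ℕd<d a n)

  toℤ-residue : ∀ a → toℤ (residue a) ≡ a [mod n ]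
  toℤ-residue a = subst (λ r → + r ≡ a [mod n ]) (sym (toℕ-fromℕ< (n%ℕd<d a n)))
    (≡-mod-sym (multiple-offset⇒≡-mod (a /ℕ n) (a≡a%ℕn+[a/ℕn]*n a n)))

  ≤-≡-mod⇒≡ : ∀ {x y} → y ≤ x → x < n → + x ≡ + y [mod n ] → x ≡ y
  ≤-≡-mod⇒≡ {x} {y} y≤x x<n (≡-mod n∣x-y) =
    ℕ.≤-antisym (ℕ.m∸n≡0⇒m≤n (multiple-below-n≡0 (ℕ.≤-<-trans (ℕ.m∸n≤m x y) x<n) n∣x∸y)) y≤x
    where
    n∣x∸y : n ℕ.∣ x ℕ.∸ y
    n∣x∸y = subst (λ z → n ℕ.∣ ℤ.∣ z ∣) (trans (ℤ.m-n≡m⊖n x y) (ℤ.⊖-≥ y≤x)) (Signed.∣⇒∣ᵤ n∣x-y)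
    multiple-below-n≡0 : ∀ {d} → d < n → n ℕ.∣ d → d ≡ 0
    multiple-below-n≡0 {ℕ.zero} _ _ = refl
    multiple-below-n≡0 {suc d} d<n n∣d = ⊥-elim (ℕ.>⇒∤ d<n n∣d)

  toℤ-injective-mod : ∀ {x y} → toℤ x ≡ toℤ y [mod n ] → x ≡ y
  toℤ-injective-mod {x} {y} x≡y with ℕ.≤-total (toℕ y) (toℕ x)
  ... | inj₁ y≤x = toℕ-injective (≤-≡-mod⇒≡ y≤x (toℕ<n x) x≡y)
  ... | inj₂ x≤y = toℕ-injective (sym (≤-≡-mod⇒≡ x≤y (toℕ<n y) (≡-mod-sym x≡y)))

  residue-cong : ∀ {a b} → a ≡ b [mod n ] → residue a ≡ residue b
  residue-cong {a} {b} a≡b = toℤ-injective-mod (begin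
    toℤ (residue a)  ≈⟨ toℤ-residue a ⟩
    a                ≈⟨ a≡b ⟩
    b                ≈⟨ toℤ-residue b ⟨
    toℤ (residue b)  ∎)
    where open ≡-mod-Reasoning

  residue-toℤ : ∀ x → residue (toℤ x) ≡ x
  residue-toℤ x = toℤ-injective-mod (toℤ-residue (toℤ x))

  infix 4 _∈ᵣ_

  _∈ᵣ_ : ℤ → Subset n → Set
  a ∈ᵣ p = residue a ∈ p

  ∈ᵣ-resp-≡-mod : ∀ {a b p} → a ≡ b [mod n ] → a ∈ᵣ p → b ∈ᵣ p
  ∈ᵣ-resp-≡-mod {p = p} a≡b = subst (_∈ p) (residue-cong a≡b)

  translate : ℤ → Subset n → Subset n
  translate e p = tabulate (λ x → lookup p (residue (toℤ x - e)))

  ∈-translate⁺ : ∀ {e a p} → a ∈ᵣ p → a + e ∈ᵣ translate e p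
  ∈-translate⁺ {e} {a} {p} a∈p = lookup⇒[]= _ _ (begin
    lookup (translate e p) (residue (a + e))        ≡⟨ lookup∘tabulate _ (residue (a + e)) ⟩
    lookup p (residue (toℤ (residue (a + e)) - e))  ≡⟨ cong (lookup p) (residue-cong shift-back) ⟩
    lookup p (residue a)                            ≡⟨ []=⇒lookup a∈p ⟩
    true                                            ∎)
    where
    open ≡-Reasoning
    shift-back : toℤ (residue (a + e)) - e ≡ a [mod n ]
    shift-back = ≡-mod-trans (+-cong-mod (toℤ-residue (a + e)) (≡⇒≡-mod {a = - e} refl))
                             (≡⇒≡-mod (cancel a e))
      where cancel : ∀ a e → a + e - e ≡ a
            cancel = solve-∀

  ∈-translate⁻ : ∀ {e x p} → x ∈ translate e p → toℤ x - e ∈ᵣ p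
  ∈-translate⁻ {e} {x} {p} x∈ =
    lookup⇒[]= _ _ (trans (sym (lookup∘tabulate _ x)) ([]=⇒lookup x∈))

  Invertible : ℤ → Set
  Invertible e = ∃ λ u → u ℤ.* e ≡ 1ℤ [mod n ]

  translation-closed⇒full : ∀ {e p} → Invertible e → 0ℤ ∈ᵣ p →
                            (∀ a → a ∈ᵣ p → a + e ∈ᵣ p) → ∀ x → x ∈ p
  translation-closed⇒full {e} {p} (u , ue≡1) 0∈p closed x =
    subst (_∈ p) (residue-toℤ x) (∈ᵣ-resp-≡-mod je≡x (multiples j))
    where
    multiples : ∀ j → + j ℤ.* e ∈ᵣ p
    multiples ℕ.zero = subst (_∈ᵣ p) (sym (ℤ.*-zeroˡ e)) 0∈p
    multiples (suc j) =
      subst (_∈ᵣ p) (trans (ℤ.+-comm _ e) (sym (ℤ.suc-* (+ j) e))) (closed (+ j ℤ.* e) (multiples j))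

    j : ℕ
    j = toℕ (residue (toℤ x ℤ.* u))

    je≡x : + j ℤ.* e ≡ toℤ x [mod n ]
    je≡x = begin
      + j ℤ.* e              ≈⟨ *-congʳ-mod e (toℤ-residue (toℤ x ℤ.* u)) ⟩
      toℤ x ℤ.* u ℤ.* e      ≡⟨ ℤ.*-assoc (toℤ x) u e ⟩
      toℤ x ℤ.* (u ℤ.* e)    ≈⟨ *-congˡ-mod (toℤ x) ue≡1 ⟩
      toℤ x ℤ.* 1ℤ           ≡⟨ ℤ.*-identityʳ (toℤ x) ⟩
      toℤ x                  ∎
      where open ≡-mod-Reasoning

  subsetSums : (k : ℕ) → (Fin k → ℤ) → Subset n
  subsetSums ℕ.zero d = ⁅ residue 0ℤ ⁆
  subsetSums (suc k) d = subsetSums k (d ∘ suc) ∪ translate (d zero) (subsetSums k (d ∘ suc))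

  0∈subsetSums : ∀ k d → 0ℤ ∈ᵣ subsetSums k d
  0∈subsetSums ℕ.zero d = x∈⁅x⁆ _
  0∈subsetSums (suc k) d = p⊆p∪q _ (0∈subsetSums k (d ∘ suc))

  subsetSums-sound : ∀ k d {x} → x ∈ subsetSums k d → ∃ λ A → selectedSum k A d ≡ toℤ x [mod n ]
  subsetSums-sound ℕ.zero d x∈ with x∈⁅y⁆⇒x≡y _ x∈
  ... | refl = (λ ()) , ≡-mod-sym (toℤ-residue 0ℤ)
  subsetSums-sound (suc k) d {x} x∈ with x∈p∪q⁻ _ _ x∈
  ... | inj₁ x∈S =
    let A , ΣA≡x = subsetSums-sound k (d ∘ suc) x∈S
    in false ∷ A , ≡-mod-trans (≡⇒≡-mod (ℤ.+-identityˡ _)) ΣA≡x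
  ... | inj₂ x∈T =
    let A , ΣA≡x-e = subsetSums-sound k (d ∘ suc) (∈-translate⁻ {d zero} x∈T)
    in true ∷ A , (begin
      d zero + selectedSum k A (d ∘ suc)          ≈⟨ +-congˡ-mod (d zero) ΣA≡x-e ⟩
      d zero + toℤ (residue (toℤ x - d zero))     ≈⟨ +-congˡ-mod (d zero) (toℤ-residue _) ⟩
      d zero + (toℤ x - d zero)                   ≡⟨ cancel (d zero) (toℤ x) ⟩
      toℤ x                                       ∎)
    where
    open ≡-mod-Reasoning
    cancel : ∀ e a → e + (a - e) ≡ a
    cancel = solve-∀

  subsetSums-grows : ∀ k d → (∀ i → Invertible (d i)) →
                     suc k ≤ ∣ subsetSums k d ∣ ⊎ (∀ x → x ∈ subsetSums k d)
  subsetSums-grows ℕ.zero d _ = inj₁ (ℕ.≤-reflexive (sym (∣⁅x⁆∣≡1 (residue 0ℤ))))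
  subsetSums-grows (suc k) d inv with subsetSums-grows k (d ∘ suc) (inv ∘ suc)
  ... | inj₂ full = inj₂ (λ x → p⊆p∪q _ (full x))
  ... | inj₁ large with ⊆⇒⊇⊎⊂ (p⊆p∪q (translate (d zero) (subsetSums k (d ∘ suc))))
  ...   | inj₂ S⊂T = inj₁ (ℕ.≤-trans (s≤s large) (p⊂q⇒∣p∣<∣q∣ S⊂T))
  ...   | inj₁ T⊆S = inj₂ (λ x → p⊆p∪q _ (S-full x))
    where
    S-full : ∀ x → x ∈ subsetSums k (d ∘ suc)
    S-full = translation-closed⇒full (inv zero) (0∈subsetSums k (d ∘ suc))
               (λ a a∈S → T⊆S (q⊆p∪q _ _ (∈-translate⁺ {a = a} a∈S)))

  subsetSums-complete : ∀ d → (∀ i → Invertible (d i)) → ∀ a → ∃ λ A → selectedSum n A d ≡ a [mod n ]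
  subsetSums-complete d inv a with subsetSums-grows n d inv
  ... | inj₁ too-large = ⊥-elim (ℕ.<⇒≱ too-large (∣p∣≤n (subsetSums n d)))
  ... | inj₂ full =
    let A , ΣA≡a = subsetSums-sound n d (full (residue a))
    in A , ≡-mod-trans ΣA≡a (toℤ-residue a)

  bézout⇒invertible : ∀ {k} → Bézout.Identity 1 k n → Invertible (+ k)
  bézout⇒invertible {k} (Bézout.+- x y 1+yn≡xk) =
    + x , multiple-offset⇒≡-mod (+ y) (sym (1+m*n≡o*p⇒ℤ y n x k 1+yn≡xk))
  bézout⇒invertible {k} (Bézout.-+ x y 1+xk≡yn) =
    - + x , multiple-offset⇒≡-mod (- + y) (begin
      - + x ℤ.* + k               ≡⟨ negate (+ x) (+ k) ⟩
      1ℤ - (1ℤ + + x ℤ.* + k)     ≡⟨ cong (_-_ 1ℤ) (1+m*n≡o*p⇒ℤ x k y n 1+xk≡yn) ⟩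
      1ℤ - + y ℤ.* + n            ≡⟨ cong (_+_ 1ℤ) (ℤ.neg-distribˡ-* (+ y) (+ n)) ⟩
      1ℤ + - + y ℤ.* + n          ∎)
    where
    open ≡-Reasoning
    negate : ∀ x k → - x ℤ.* k ≡ 1ℤ - (1ℤ + x ℤ.* k)
    negate = solve-∀

  unit⇒invertible : ∀ {e} → IsUnitMod n e → Invertible e
  unit⇒invertible {e} unit with ℤ.+∣i∣≡i⊎+∣i∣≡-i e | bézout⇒invertible (coprime-Bézout unit)
  ... | inj₁ ∣e∣≡e | u , u∣e∣≡1 = u , subst (λ e′ → u ℤ.* e′ ≡ 1ℤ [mod n ]) ∣e∣≡e u∣e∣≡1
  ... | inj₂ ∣e∣≡-e | u , u∣e∣≡1 = - u , subst (_≡ 1ℤ [mod n ]) u∣e∣≡-ue u∣e∣≡1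
    where
    u∣e∣≡-ue : u ℤ.* + ℤ.∣ e ∣ ≡ - u ℤ.* e
    u∣e∣≡-ue = trans (cong (u ℤ.*_) ∣e∣≡-e) (trans (sym (ℤ.neg-distribʳ-* u e)) (ℤ.neg-distribˡ-* u e))

IsUnitMod-∣ : ∀ {m k} e → m ℕ.∣ k → IsUnitMod k e → IsUnitMod m e
IsUnitMod-∣ e m∣k unit (i∣e , i∣m) = unit (i∣e , ℕ.∣-trans i∣m m∣k)

unit⇒odd : ∀ {e} → IsUnitMod 2 e → e ≡ 1ℤ [mod 2 ]
unit⇒odd {e} unit with Residues.residue 2 e | Residues.toℤ-residue 2 e
... | zero | 0≡e = ⊥-elim (2≢1 (unit (2∣e , ℕ.∣-refl)))
  where
  2∣e : 2 ℕ.∣ ℤ.∣ e ∣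
  2∣e = subst (λ z → 2 ℕ.∣ ℤ.∣ z ∣) (ℤ.+-identityʳ e) (Signed.∣⇒∣ᵤ (m∣a-b (≡-mod-sym 0≡e)))
  2≢1 : 2 ≢ 1
  2≢1 ()
... | suc zero | 1≡e = ≡-mod-sym 1≡e

sum-of-odd≡length : ∀ k d → (∀ i → d i ≡ 1ℤ [mod 2 ]) → Σᶠ k d ≡ + k [mod 2 ]
sum-of-odd≡length ℕ.zero d odd = ≡⇒≡-mod refl
sum-of-odd≡length (suc k) d odd = +-cong-mod (odd zero) (sum-of-odd≡length k (d ∘ suc) (odd ∘ suc))

signOf : Bool → Sign
signOf true = Sign.-
signOf false = Sign.+

signedSum≡sum-2*selectedSum : ∀ k A d →
  Σᶠ k (λ i → signℤ (signOf (A i)) ℤ.* d i) ≡ Σᶠ k d - + 2 ℤ.* selectedSum k A d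
signedSum≡sum-2*selectedSum ℕ.zero A d = refl
signedSum≡sum-2*selectedSum (suc k) A d with A zero
... | true = begin
  - 1ℤ ℤ.* d zero + Σᶠ k (λ i → signℤ (signOf (A (suc i))) ℤ.* d (suc i))
    ≡⟨ cong₂ _+_ (ℤ.-1*i≡-i (d zero)) (signedSum≡sum-2*selectedSum k (A ∘ suc) (d ∘ suc)) ⟩
  - d zero + (Σᶠ k (d ∘ suc) - + 2 ℤ.* selectedSum k (A ∘ suc) (d ∘ suc))
    ≡⟨ regroup (d zero) _ _ ⟩
  (d zero + Σᶠ k (d ∘ suc)) - + 2 ℤ.* (d zero + selectedSum k (A ∘ suc) (d ∘ suc))  ∎
  where
  open ≡-Reasoning
  regroup : ∀ a D S → - a + (D - + 2 ℤ.* S) ≡ (a + D) - + 2 ℤ.* (a + S)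
  regroup = solve-∀
... | false = begin
  1ℤ ℤ.* d zero + Σᶠ k (λ i → signℤ (signOf (A (suc i))) ℤ.* d (suc i))
    ≡⟨ cong₂ _+_ (ℤ.*-identityˡ (d zero)) (signedSum≡sum-2*selectedSum k (A ∘ suc) (d ∘ suc)) ⟩
  d zero + (Σᶠ k (d ∘ suc) - + 2 ℤ.* selectedSum k (A ∘ suc) (d ∘ suc))
    ≡⟨ regroup (d zero) _ _ ⟩
  (d zero + Σᶠ k (d ∘ suc)) - + 2 ℤ.* (0ℤ + selectedSum k (A ∘ suc) (d ∘ suc))  ∎
  where
  open ≡-Reasoning
  regroup : ∀ a D S → a + (D - + 2 ℤ.* S) ≡ (a + D) - + 2 ℤ.* (0ℤ + S)
  regroup = solve-∀

theorem2p2 : (n : ℕ) → .{{_ : NonZero n}} → (d : Fin n → ℤ) →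
    (∀ i → IsUnitMod (2 * n) (d i)) →
    ∃ λ (s : Fin n → Sign) →
    (+ (2 * n)) ∣ (Σᶠ n (λ i → signℤ (s i) Data.Integer.* d i) - + n)
theorem2p2 n d units =
  let A , ΣA≡q = subsetSums-complete d invertible q
  in signOf ∘ A , Signed.∣⇒∣ᵤ (m∣a-b (signedSum≡n A ΣA≡q))
  where
  open Residues n
  Σd : ℤ
  Σd = Σᶠ n d

  invertible : ∀ i → Invertible (d i)
  invertible i = unit⇒invertible (IsUnitMod-∣ (d i) (ℕ.n∣m*n 2) (units i))

  Σd-n≡2q : + 2 Signed.∣ Σd - + n
  Σd-n≡2q = m∣a-b (sum-of-odd≡length n d (λ i → unit⇒odd (IsUnitMod-∣ (d i) (ℕ.m∣m*n n) (units i))))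

  q : ℤ
  q = Signed._∣_.quotient Σd-n≡2q

  signedSum≡n : ∀ A → selectedSum n A d ≡ q [mod n ] →
                Σᶠ n (λ i → signℤ (signOf (A i)) ℤ.* d i) ≡ + n [mod 2 * n ]
  signedSum≡n A ΣA≡q = begin
    Σᶠ n (λ i → signℤ (signOf (A i)) ℤ.* d i)  ≡⟨ signedSum≡sum-2*selectedSum n A d ⟩
    Σd - + 2 ℤ.* selectedSum n A d              ≈⟨ +-congˡ-mod Σd (-‿cong-mod (*-scale-mod 2 ΣA≡q)) ⟩
    Σd - + 2 ℤ.* q                              ≡⟨ regroup Σd (+ n) q ⟩
    + n + ((Σd - + n) - q ℤ.* + 2)              ≡⟨ cong (λ t → + n + (t - q ℤ.* + 2)) (Signed._∣_.equality Σd-n≡2q) ⟩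
    + n + (q ℤ.* + 2 - q ℤ.* + 2)               ≡⟨ cancel (+ n) (q ℤ.* + 2) ⟩
    + n                                         ∎
    where
    open ≡-mod-Reasoning
    regroup : ∀ s n q → s - + 2 ℤ.* q ≡ n + ((s - n) - q ℤ.* + 2)
    regroup = solve-∀
    cancel : ∀ n t → n + (t - t) ≡ n
    cancel = solve-∀
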